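{- Let $G=(V,E)$ be a graph without isolated vertices with $\sigma(G)\ge 2$, and let $\lambda$ be a sum labelling of $G+N_{\sigma(G)}$ in which the two largest labels of isolated vertices are $\iota_1,\iota_2$. If $\iota_1+\iota_2\ne\lambda(u)+\lambda(v)$ for any two vertices $u,v\in V$, then $\sigma(G+P_k)\le\sigma(G)-1$ for every $k\ge 2$.
   Context: A graph $H=(V,E)$ is a sum graph with sum labelling $\lambda$ if $\lambda:V\to\mathbb{N}$ is injective and $E=\{xy : \exists z\in V,\ \lambda(z)=\lambda(x)+\lambda(y)\}$. For a graph $G$ without isolated vertices, $\sigma(G)$ is the minimum $k$ such that $G+N_k$ is a sum graph ($N_k$: $k$ isolated vertices, $+$: disjoint union). $P_k$ is the path on $k$ vertices. -}

module Defs where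

open import Data.Nat using (ℕ; zero; suc; _+_; _<_; _≤_)
open import Data.Fin using (Fin; toℕ; splitAt; _↑ˡ_; _↑ʳ_)
open import Data.Sum using (_⊎_; inj₁; inj₂)
open import Data.Product using (Σ; ∃; _×_; _,_)
open import Data.Empty using (⊥)
open import Relation.Nullary using (¬_)
open import Relation.Binary.PropositionalEquality using (_≡_; _≢_; sym)
open import Function.Bundles using (_⇔_)

record Graph : Set₁ where
  field
    n      : ℕ
    Adj    : Fin n → Fin n → Set
    sym'   : ∀ {x y} → Adj x y → Adj y x
    irrefl : ∀ {x} → ¬ Adj x x
open Graph public

-- Disjoint union G + H: vertices of G are x ↑ˡ n H, vertices of H are n G ↑ʳ y.
module _ (G H : Graph) where
  UAdj : Fin (n G) ⊎ Fin (n H) → Fin (n G) ⊎ Fin (n H) → Set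
  UAdj (inj₁ x) (inj₁ y) = Adj G x y
  UAdj (inj₂ x) (inj₂ y) = Adj H x y
  UAdj _ _ = ⊥

  UAdj-sym : ∀ a b → UAdj a b → UAdj b a
  UAdj-sym (inj₁ x) (inj₁ y) p = sym' G p
  UAdj-sym (inj₂ x) (inj₂ y) p = sym' H p

  UAdj-irrefl : ∀ a → ¬ UAdj a a
  UAdj-irrefl (inj₁ x) = irrefl G
  UAdj-irrefl (inj₂ x) = irrefl H

infixl 6 _⊕_
_⊕_ : Graph → Graph → Graph
G ⊕ H = record
  { n = n G + n H
  ; Adj = λ x y → UAdj G H (splitAt (n G) x) (splitAt (n G) y)
  ; sym' = λ {x} {y} → UAdj-sym G H (splitAt (n G) x) (splitAt (n G) y)
  ; irrefl = λ {x} → UAdj-irrefl G H (splitAt (n G) x)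
  }

N : ℕ → Graph
N k = record { n = k ; Adj = λ _ _ → ⊥ ; sym' = λ () ; irrefl = λ () }

PAdj : ∀ {k} → Fin k → Fin k → Set
PAdj i j = toℕ j ≡ suc (toℕ i) ⊎ toℕ i ≡ suc (toℕ j)

PAdj-irrefl : ∀ {k} {i : Fin k} → ¬ PAdj i i
PAdj-irrefl (inj₁ e) = n≢sn e
  where
  n≢sn : ∀ {m} → m ≢ suc m
  n≢sn ()
PAdj-irrefl (inj₂ e) = n≢sn e
  where
  n≢sn : ∀ {m} → m ≢ suc m
  n≢sn ()

P : ℕ → Graph
P k = record
  { n = k
  ; Adj = PAdj
  ; sym' = λ { (inj₁ e) → inj₂ e ; (inj₂ e) → inj₁ e }
  ; irrefl = PAdj-irrefl
  }

NoIsolated : Graph → Set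
NoIsolated G = ∀ x → ∃ λ y → Adj G x y

record SumLabelling (H : Graph) : Set where
  field
    lab     : Fin (n H) → ℕ
    inj     : ∀ x y → lab x ≡ lab y → x ≡ y
    pos     : ∀ x → 0 < lab x
    edges   : ∀ x y → x ≢ y →
              (Adj H x y ⇔ (∃ λ z → lab z ≡ lab x + lab y))
open SumLabelling public

IsSumGraph : Graph → Set
IsSumGraph H = SumLabelling H

IsSigma : Graph → ℕ → Set
IsSigma G s = IsSumGraph (G ⊕ N s) × (∀ k → k < s → ¬ IsSumGraph (G ⊕ N k))

{-# OPTIONS --safe #-}
module Submission where

-- Since G has no isolated vertex, the largest label of L is ι₁. Keep all labels except
-- ι₁ and ι₂, label the path by fib 0, …, fib (k-1) for the sequence ι₂, ι₁, ι₂+ι₁, …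
-- (so it starts at the old isolated vertices of ι₂ and ι₁), and add one isolated vertex
-- labelled fib k. Consecutive path labels sum to the next term. Any other new sum either
-- lies strictly between two consecutive terms above ι₁, or lies below fib 3, where the
-- only new label is fib 2 = ι₂ + ι₁; an old label there is impossible for a sum with an
-- isolated vertex of L, and is exactly the old edge criterion for two vertices of G.
-- The hypothesis rules out two labels of G summing to fib 2.

open import Defs
open import Data.Nat using (ℕ; suc; _≤_; _<_; _∸_; _+_; z≤n; s≤s; _≤?_)
open import Data.Nat.Properties
open import Data.Fin using (Fin; _↑ˡ_; _↑ʳ_; toℕ; splitAt; punchIn; punchOut; fromℕ<)
import Data.Fin as Fin
open import Data.Fin.Properties
  using (↑ˡ-injective; ↑ʳ-injective; splitAt-↑ˡ; splitAt-↑ʳ; splitAt⁻¹-↑ˡ; splitAt⁻¹-↑ʳ; +↔⊎;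
         toℕ<n; toℕ-fromℕ<; toℕ-injective;
         punchInᵢ≢i; punchIn-injective; punchIn-punchOut; punchOut-injective)
open import Data.List.Base using (allFin)
open import Data.List.Extrema.Nat using (argmax; f[xs]≤f[argmax])
open import Data.List.Relation.Unary.All using (lookup)
open import Data.List.Membership.Propositional.Properties using (∈-allFin)
open import Data.Sum using (_⊎_; inj₁; inj₂; map₁)
open import Data.Sum.Function.Propositional using (_⊎-↔_)
open import Data.Product using (∃; _×_; _,_; proj₁; proj₂)
open import Data.Empty using (⊥; ⊥-elim)
open import Relation.Nullary using (¬_; yes; no; contradiction)
open import Relation.Binary.PropositionalEquality
open import Relation.Binary.Definitions using (tri<; tri≈; tri>)
open import Function.Base using (_∘_)
open import Function.Bundles using (_⇔_; _↔_; mk⇔; Equivalence; Inverse)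
open import Function.Construct.Composition using (_⇔-∘_)
open import Function.Construct.Identity using (⇔-id)
open import Function.Construct.Symmetry using (⇔-sym)
open import Function.Properties.Inverse using (↔-trans; ↔-refl)

↑ˡ≢↑ʳ : ∀ {m n} (u : Fin m) (j : Fin n) → u ↑ˡ n ≢ m ↑ʳ j
↑ˡ≢↑ʳ {m} {n} u j e with trans (sym (splitAt-↑ˡ m u n)) (trans (cong (splitAt m) e) (splitAt-↑ʳ m n j))
... | ()

exists-maximum : ∀ {m} (f : Fin m → ℕ) → Fin m → ∃ λ w → ∀ z → f z ≤ f w
exists-maximum f z₀ = argmax f z₀ (allFin _) , λ z → lookup (f[xs]≤f[argmax] z₀ (allFin _)) (∈-allFin z)

module _ {n} {i₁ i₂ : Fin (suc (suc n))} (i₁≢i₂ : i₁ ≢ i₂) where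

  punchIn₂ : Fin n → Fin (suc (suc n))
  punchIn₂ = punchIn i₁ ∘ punchIn (punchOut i₁≢i₂)

  punchIn₂≢ˡ : ∀ j → punchIn₂ j ≢ i₁
  punchIn₂≢ˡ j = punchInᵢ≢i i₁ _

  punchIn₂≢ʳ : ∀ j → punchIn₂ j ≢ i₂
  punchIn₂≢ʳ j e = punchInᵢ≢i (punchOut i₁≢i₂) j
    (punchIn-injective i₁ _ _ (trans e (sym (punchIn-punchOut i₁≢i₂))))

  punchIn₂-injective : ∀ j j′ → punchIn₂ j ≡ punchIn₂ j′ → j ≡ j′
  punchIn₂-injective j j′ = punchIn-injective _ j j′ ∘ punchIn-injective i₁ _ _

  punchIn₂-surjective : ∀ j → j ≢ i₁ → j ≢ i₂ → ∃ λ j′ → punchIn₂ j′ ≡ j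
  punchIn₂-surjective j j≢i₁ j≢i₂ =
    punchOut i₂′≢j₁ , trans (cong (punchIn i₁) (punchIn-punchOut i₂′≢j₁)) (punchIn-punchOut i₁≢j)
    where
    i₁≢j : i₁ ≢ j
    i₁≢j = j≢i₁ ∘ sym
    i₂′≢j₁ : punchOut i₁≢i₂ ≢ punchOut i₁≢j
    i₂′≢j₁ e = j≢i₂ (sym (punchOut-injective i₁≢i₂ i₁≢j e))

module Fibonacci (a b : ℕ) where

  fib : ℕ → ℕ
  fib 0 = a
  fib 1 = b
  fib (suc (suc i)) = fib i + fib (suc i)

  -- fib carries no proofs: with-abstraction normalises goals mentioning fib.
  module Properties (0<a : 0 < a) (a<b : a < b) where

    fib-pos : ∀ i → 0 < fib i
    fib-pos 0 = 0<a
    fib-pos 1 = <-trans 0<a a<b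
    fib-pos (suc (suc i)) = <-≤-trans (fib-pos i) (m≤m+n _ _)

    fib-<-suc : ∀ i → fib i < fib (suc i)
    fib-<-suc 0 = a<b
    fib-<-suc (suc i) = m<n+m (fib (suc i)) (fib-pos i)

    fib-strictMono : ∀ {i j} → i < j → fib i < fib j
    fib-strictMono {i} {suc j} (s≤s i≤j) with m≤n⇒m<n∨m≡n i≤j
    ... | inj₁ i<j = <-trans (fib-strictMono i<j) (fib-<-suc j)
    ... | inj₂ refl = fib-<-suc i

    fib-mono : ∀ {i j} → i ≤ j → fib i ≤ fib j
    fib-mono i≤j with m≤n⇒m<n∨m≡n i≤j
    ... | inj₁ i<j = <⇒≤ (fib-strictMono i<j)
    ... | inj₂ refl = ≤-refl

    fib-injective : ∀ {i j} → fib i ≡ fib j → i ≡ j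
    fib-injective {i} {j} e with <-cmp i j
    ... | tri< i<j _ _ = contradiction e (<⇒≢ (fib-strictMono i<j))
    ... | tri≈ _ i≡j _ = i≡j
    ... | tri> _ _ j<i = contradiction (sym e) (<⇒≢ (fib-strictMono j<i))

    fib-gap : ∀ {x} m → 0 < x → x < fib m → ∀ i → x + fib (suc m) ≢ fib i
    fib-gap {x} m 0<x x<fib i e with i ≤? suc m
    ... | yes i≤ = <⇒≱ (m<n+m (fib (suc m)) 0<x) (subst (_≤ fib (suc m)) (sym e) (fib-mono i≤))
    ... | no i≰ = <⇒≱ (+-monoˡ-< (fib (suc m)) x<fib) (subst (fib (suc (suc m)) ≤_) (sym e) (fib-mono (≰⇒> i≰)))

IsLabel : ∀ {H} → SumLabelling H → ℕ → Set
IsLabel {H} L v = ∃ λ (z : Fin (n H)) → lab L z ≡ v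

Adj-⊕-↑ˡ : ∀ G H (u v : Fin (n G)) → Adj (G ⊕ H) (u ↑ˡ n H) (v ↑ˡ n H) ⇔ Adj G u v
Adj-⊕-↑ˡ G H u v rewrite splitAt-↑ˡ (n G) u (n H) | splitAt-↑ˡ (n G) v (n H) = ⇔-id _

¬Adj-⊕-N-↑ʳ : ∀ G s j w → ¬ Adj (G ⊕ N s) (n G ↑ʳ j) w
¬Adj-⊕-N-↑ʳ G s j w rewrite splitAt-↑ʳ (n G) s j with splitAt (n G) w
... | inj₁ _ = λ ()
... | inj₂ _ = λ ()

module _ {G : Graph} {s : ℕ} (L : SumLabelling (G ⊕ N s)) where

  isolated-sum : ∀ j w → w ≢ n G ↑ʳ j → ¬ IsLabel L (lab L w + lab L (n G ↑ʳ j))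
  isolated-sum j w w≢j =
    ¬Adj-⊕-N-↑ʳ G s j w ∘ sym' (G ⊕ N s) ∘ Equivalence.from (edges L w _ w≢j)

  edge⇔sum-label : ∀ {u v} → u ≢ v → Adj G u v ⇔ IsLabel L (lab L (u ↑ˡ s) + lab L (v ↑ˡ s))
  edge⇔sum-label {u} {v} u≢v =
    edges L _ _ (u≢v ∘ ↑ˡ-injective s u v) ⇔-∘ ⇔-sym (Adj-⊕-↑ˡ G (N s) u v)

  label-not-maximal : NoIsolated G → ∀ u → ∃ λ z → lab L (u ↑ˡ s) < lab L z
  label-not-maximal noIsolated u with noIsolated u
  ... | v , uv with Equivalence.to (edge⇔sum-label (λ { refl → irrefl G uv })) uv
  ...   | z , e = z , subst (lab L (u ↑ˡ s) <_) (sym e) (m<m+n _ (pos L (v ↑ˡ s)))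

  maximum-label-isolated : NoIsolated G → Fin s → ∃ λ j → ∀ z → lab L z ≤ lab L (n G ↑ʳ j)
  maximum-label-isolated noIsolated j₀ with exists-maximum (lab L) (n G ↑ʳ j₀)
  ... | w , w-max with splitAt (n G) w in eq
  ...   | inj₂ j = j , subst (λ t → ∀ z → lab L z ≤ lab L t) (sym (splitAt⁻¹-↑ʳ eq)) w-max
  ...   | inj₁ u with label-not-maximal noIsolated u
  ...     | z , u<z = contradiction (w-max z)
                        (<⇒≱ (subst (λ t → lab L t < lab L z) (splitAt⁻¹-↑ˡ eq) u<z))

sumLabelling-via : (H : Graph) {K : Set} (vertices : Fin (n H) ↔ K) (Edge : K → K → Set) →
  (∀ x y → Adj H x y ⇔ Edge (Inverse.to vertices x) (Inverse.to vertices y)) →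
  (label : K → ℕ) → (∀ κ μ → label κ ≡ label μ → κ ≡ μ) → (∀ κ → 0 < label κ) →
  (∀ κ μ → κ ≢ μ → Edge κ μ ⇔ ∃ λ ν → label ν ≡ label κ + label μ) →
  SumLabelling H
sumLabelling-via H vertices Edge adj label label-inj label-pos sums = record
  { lab = label ∘ to
  ; inj = λ x y → to-injective ∘ label-inj (to x) (to y)
  ; pos = label-pos ∘ to
  ; edges = λ x y x≢y → preimage ⇔-∘ (sums (to x) (to y) (x≢y ∘ to-injective) ⇔-∘ adj x y)
  }
  where
  open Inverse vertices
  to-injective : ∀ {x y} → to x ≡ to y → x ≡ y
  to-injective {x} {y} e = trans (sym (strictlyInverseʳ x)) (trans (cong from e) (strictlyInverseʳ y))
  preimage : ∀ {v} → (∃ λ ν → label ν ≡ v) ⇔ (∃ λ z → label (to z) ≡ v)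
  preimage = mk⇔ (λ (ν , e) → from ν , trans (cong label (strictlyInverseˡ ν)) e) (λ (z , e) → to z , e)

module Construction
  (G : Graph) (noIsolated : NoIsolated G) (r : ℕ) (L : SumLabelling (G ⊕ N (suc (suc r))))
  (i₁ i₂ : Fin (suc (suc r))) (i₁≢i₂ : i₁ ≢ i₂)
  (ι₂≤ι₁ : lab L (n G ↑ʳ i₂) ≤ lab L (n G ↑ʳ i₁))
  (≤ι₂ : ∀ j → j ≢ i₁ → lab L (n G ↑ʳ j) ≤ lab L (n G ↑ʳ i₂))
  (ι₁+ι₂≢ : ∀ u v → lab L (n G ↑ʳ i₁) + lab L (n G ↑ʳ i₂) ≢ lab L (u ↑ˡ suc (suc r)) + lab L (v ↑ˡ suc (suc r)))
  (k : ℕ) (0<k : 0 < k)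
  where

  S : ℕ
  S = suc (suc r)

  ℓ : Fin (n G + S) → ℕ
  ℓ = lab L

  iv : Fin S → Fin (n G + S)
  iv j = n G ↑ʳ j

  ι₁ ι₂ : ℕ
  ι₁ = ℓ (iv i₁)
  ι₂ = ℓ (iv i₂)

  label≤ι₁ : ∀ z → ℓ z ≤ ι₁
  label≤ι₁ z with maximum-label-isolated L noIsolated i₁
  ... | j , max with j Fin.≟ i₁
  ...   | yes refl = max z
  ...   | no j≢i₁ = ≤-trans (max z) (≤-trans (≤ι₂ j j≢i₁) ι₂≤ι₁)

  label<ι₁ : ∀ z → z ≢ iv i₁ → ℓ z < ι₁
  label<ι₁ z z≢i₁ = ≤∧≢⇒< (label≤ι₁ z) (z≢i₁ ∘ inj L _ _)

  ι₂<ι₁ : ι₂ < ι₁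
  ι₂<ι₁ = label<ι₁ (iv i₂) (i₁≢i₂ ∘ sym ∘ ↑ʳ-injective (n G) i₂ i₁)

  open Fibonacci ι₂ ι₁
  open Fibonacci.Properties ι₂ ι₁ (pos L (iv i₂)) ι₂<ι₁

  Kept : Fin (n G + S) → Set
  Kept z = z ≢ iv i₁ × z ≢ iv i₂

  isolated<ι₂ : ∀ j → Kept (iv j) → ℓ (iv j) < ι₂
  isolated<ι₂ j (≢i₁ , ≢i₂) = ≤∧≢⇒< (≤ι₂ j (≢i₁ ∘ cong iv)) (≢i₂ ∘ inj L _ _)

  old : Fin r → Fin S
  old = punchIn₂ i₁≢i₂

  graph-kept : ∀ u → Kept (u ↑ˡ S)
  graph-kept u = ↑ˡ≢↑ʳ u i₁ , ↑ˡ≢↑ʳ u i₂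

  old-kept : ∀ j → Kept (iv (old j))
  old-kept j = punchIn₂≢ˡ i₁≢i₂ j ∘ ↑ʳ-injective (n G) _ _ , punchIn₂≢ʳ i₁≢i₂ j ∘ ↑ʳ-injective (n G) _ _

  -- The old isolated vertices i₂, i₁ become the path vertices 0, 1 (labels fib 0, fib 1);
  -- isolated vertex 0 is new, labelled fib k, and isolated vertex suc j is old j.
  K : Set
  K = (Fin (n G) ⊎ Fin k) ⊎ Fin (suc r)

  pattern graphV u = inj₁ (inj₁ u)
  pattern pathV m = inj₁ (inj₂ m)
  pattern newV = inj₂ Fin.zero
  pattern oldV j = inj₂ (Fin.suc j)

  label : K → ℕ
  label (graphV u) = ℓ (u ↑ˡ S)
  label (pathV m) = fib (toℕ m)
  label newV = fib k
  label (oldV j) = ℓ (iv (old j))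

  H : Graph
  H = G ⊕ P k ⊕ N (suc r)

  Edge : K → K → Set
  Edge (inj₁ a) (inj₁ b) = UAdj G (P k) a b
  Edge _ _ = ⊥

  vertices : Fin (n H) ↔ K
  vertices = ↔-trans +↔⊎ (+↔⊎ ⊎-↔ ↔-refl)

  Adj⇔Edge : ∀ x y → Adj H x y ⇔ Edge (Inverse.to vertices x) (Inverse.to vertices y)
  Adj⇔Edge x y = by-parts (splitAt (n G + k) x) (splitAt (n G + k) y)
    where
    by-parts : ∀ a b → UAdj (G ⊕ P k) (N (suc r)) a b ⇔ Edge (map₁ (splitAt (n G)) a) (map₁ (splitAt (n G)) b)
    by-parts (inj₁ a) (inj₁ b) = ⇔-id _
    by-parts (inj₁ a) (inj₂ j) = ⇔-id _
    by-parts (inj₂ i) (inj₁ b) = ⇔-id _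
    by-parts (inj₂ i) (inj₂ j) = ⇔-id _

  NewLabel : ℕ → Set
  NewLabel v = ∃ λ κ → label κ ≡ v

  newLabel-comm : ∀ x y → NewLabel (x + y) → NewLabel (y + x)
  newLabel-comm x y = subst NewLabel (+-comm x y)

  fib⇒newLabel : ∀ i → i ≤ k → NewLabel (fib i)
  fib⇒newLabel i i≤k with m≤n⇒m<n∨m≡n i≤k
  ... | inj₁ i<k = pathV (fromℕ< i<k) , cong fib (toℕ-fromℕ< i<k)
  ... | inj₂ refl = newV , refl

  isolated-newLabel : ∀ j → NewLabel (ℓ (iv j))
  isolated-newLabel j with j Fin.≟ i₁ | j Fin.≟ i₂
  ... | yes refl | _ = fib⇒newLabel 1 0<k
  ... | no _ | yes refl = fib⇒newLabel 0 z≤n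
  ... | no j≢i₁ | no j≢i₂ with punchIn₂-surjective i₁≢i₂ j j≢i₁ j≢i₂
  ...   | j′ , refl = oldV j′ , refl

  label⇒newLabel : ∀ {v} → IsLabel L v → NewLabel v
  label⇒newLabel (z , refl) with splitAt (n G) z in eq
  ... | inj₁ u = graphV u , cong ℓ (splitAt⁻¹-↑ˡ eq)
  ... | inj₂ j = subst NewLabel (cong ℓ (splitAt⁻¹-↑ʳ eq)) (isolated-newLabel j)

  fib-old-or-large : ∀ i → i ≤ k → IsLabel L (fib i) ⊎ ∃ λ i′ → 2 + i′ ≤ k × fib i ≡ fib (2 + i′)
  fib-old-or-large 0 _ = inj₁ (iv i₂ , refl)
  fib-old-or-large 1 _ = inj₁ (iv i₁ , refl)
  fib-old-or-large (suc (suc i)) i≤k = inj₂ (i , i≤k , refl)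

  newLabel-cases : ∀ {v} → NewLabel v → IsLabel L v ⊎ ∃ λ i → 2 + i ≤ k × v ≡ fib (2 + i)
  newLabel-cases (κ , refl) = cases κ
    where
    cases : ∀ κ → IsLabel L (label κ) ⊎ ∃ λ i → 2 + i ≤ k × label κ ≡ fib (2 + i)
    cases (graphV u) = inj₁ (_ , refl)
    cases (pathV m) = fib-old-or-large (toℕ m) (<⇒≤ (toℕ<n m))
    cases newV = fib-old-or-large k ≤-refl
    cases (oldV j) = inj₁ (_ , refl)

  newLabel<fib₂ : ∀ {v} → NewLabel v → v < fib 2 → IsLabel L v
  newLabel<fib₂ nl v< with newLabel-cases nl
  ... | inj₁ old-label = old-label
  ... | inj₂ (i , _ , refl) = contradiction (fib-mono (m≤m+n 2 i)) (<⇒≱ v<)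

  newLabel<fib₃ : ∀ {v} → NewLabel v → v < fib 3 → v ≢ fib 2 → IsLabel L v
  newLabel<fib₃ nl v< v≢ with newLabel-cases nl
  ... | inj₁ old-label = old-label
  ... | inj₂ (0 , _ , refl) = contradiction refl v≢
  ... | inj₂ (suc i , _ , refl) = contradiction (fib-mono (m≤m+n 3 i)) (<⇒≱ v<)

  newLabel-gap : ∀ {x} m → 0 < x → x < fib m → ¬ NewLabel (x + fib (suc m))
  newLabel-gap {x} m 0<x x< nl with newLabel-cases nl
  ... | inj₁ (z , e) = <⇒≱ ι₁<sum (subst (_≤ ι₁) e (label≤ι₁ z))
    where
    ι₁<sum : ι₁ < x + fib (suc m)
    ι₁<sum = ≤-<-trans (fib-mono {1} {suc m} (s≤s z≤n)) (m<n+m _ 0<x)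
  ... | inj₂ (i , _ , e) = fib-gap m 0<x x< (2 + i) e

  kept-label≢fib : ∀ {z} → Kept z → ∀ i → ℓ z ≢ fib i
  kept-label≢fib (_ , ≢i₂) 0 = ≢i₂ ∘ inj L _ _
  kept-label≢fib (≢i₁ , _) 1 = ≢i₁ ∘ inj L _ _
  kept-label≢fib {z} _ (suc (suc i)) = <⇒≢ (≤-<-trans (label≤ι₁ z) (fib-strictMono {1} {2 + i} (s≤s (s≤s z≤n))))

  kept+fib : ∀ {z} → Kept z → ∀ m → ¬ NewLabel (ℓ z + fib m)
  kept+fib {z} (≢i₁ , ≢i₂) 0 nl = isolated-sum L i₂ z ≢i₂ (newLabel<fib₂ nl lt)
    where
    lt : ℓ z + ι₂ < ι₂ + ι₁
    lt = subst (ℓ z + ι₂ <_) (+-comm ι₁ ι₂) (+-monoˡ-< ι₂ (label<ι₁ z ≢i₁))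
  kept+fib {z} (≢i₁ , ≢i₂) 1 nl = isolated-sum L i₁ z ≢i₁ (newLabel<fib₃ nl lt ne)
    where
    lt : ℓ z + ι₁ < ι₁ + (ι₂ + ι₁)
    lt = +-mono-<-≤ (label<ι₁ z ≢i₁) (m≤n+m ι₁ ι₂)
    ne : ℓ z + ι₁ ≢ ι₂ + ι₁
    ne = ≢i₂ ∘ inj L _ _ ∘ +-cancelʳ-≡ ι₁ _ _
  kept+fib {z} (≢i₁ , _) (suc (suc m)) =
    newLabel-gap (suc m) (pos L z) (<-≤-trans (label<ι₁ z ≢i₁) (fib-mono {1} {suc m} (s≤s z≤n)))

  kept+isolated : ∀ {z} j → Kept (iv j) → z ≢ iv i₁ → z ≢ iv j → ¬ NewLabel (ℓ z + ℓ (iv j))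
  kept+isolated {z} j j-kept z≢i₁ z≢j nl = isolated-sum L j z z≢j (newLabel<fib₂ nl lt)
    where
    lt : ℓ z + ℓ (iv j) < ι₂ + ι₁
    lt = subst (ℓ z + ℓ (iv j) <_) (+-comm ι₁ ι₂) (+-mono-< (label<ι₁ z z≢i₁) (isolated<ι₂ j j-kept))

  fib+fib : ∀ {a b} → a < b → NewLabel (fib a + fib b) → b ≡ suc a × b < k
  fib+fib {a} {suc m} (s≤s a≤m) nl with m≤n⇒m<n∨m≡n a≤m
  ... | inj₁ a<m = contradiction nl (newLabel-gap m (fib-pos a) (fib-strictMono a<m))
  ... | inj₂ refl with newLabel-cases nl
  ...   | inj₁ (z , e) = contradiction (subst (_≤ ι₁) e (label≤ι₁ z)) (<⇒≱ (fib-strictMono {1} {2 + a} (s≤s (s≤s z≤n))))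
  ...   | inj₂ (i , 2+i≤k , e) = refl , subst (_≤ k) (sym (fib-injective e)) 2+i≤k

  graph-edge : ∀ u v → u ≢ v → Adj G u v ⇔ NewLabel (ℓ (u ↑ˡ S) + ℓ (v ↑ˡ S))
  graph-edge u v u≢v = mk⇔ (label⇒newLabel ∘ to) (from ∘ old-sum)
    where
    open Equivalence (edge⇔sum-label L u≢v)
    lt : ℓ (u ↑ˡ S) + ℓ (v ↑ˡ S) < ι₁ + (ι₂ + ι₁)
    lt = +-mono-<-≤ (label<ι₁ _ (↑ˡ≢↑ʳ u i₁)) (≤-trans (label≤ι₁ _) (m≤n+m ι₁ ι₂))
    ne : ℓ (u ↑ˡ S) + ℓ (v ↑ˡ S) ≢ ι₂ + ι₁
    ne e = ι₁+ι₂≢ u v (trans (+-comm ι₁ ι₂) (sym e))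
    old-sum : NewLabel (ℓ (u ↑ˡ S) + ℓ (v ↑ˡ S)) → IsLabel L (ℓ (u ↑ˡ S) + ℓ (v ↑ˡ S))
    old-sum nl = newLabel<fib₃ nl lt ne

  path-edge : ∀ (a b : Fin k) → a ≢ b → PAdj a b ⇔ NewLabel (fib (toℕ a) + fib (toℕ b))
  path-edge a b a≢b = mk⇔ to from
    where
    consecutive : ∀ i j → j ≡ suc i → j < k → NewLabel (fib i + fib j)
    consecutive i .(suc i) refl j<k = fib⇒newLabel (2 + i) j<k
    to : PAdj a b → NewLabel (fib (toℕ a) + fib (toℕ b))
    to (inj₁ e) = consecutive _ _ e (toℕ<n b)
    to (inj₂ e) = newLabel-comm (fib (toℕ b)) (fib (toℕ a)) (consecutive (toℕ b) (toℕ a) e (toℕ<n a))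
    from : NewLabel (fib (toℕ a) + fib (toℕ b)) → PAdj a b
    from nl with <-cmp (toℕ a) (toℕ b)
    ... | tri< a<b _ _ = inj₁ (proj₁ (fib+fib a<b nl))
    ... | tri≈ _ a≡b _ = contradiction (toℕ-injective a≡b) a≢b
    ... | tri> _ _ b<a = inj₂ (proj₁ (fib+fib b<a (newLabel-comm (fib (toℕ a)) (fib (toℕ b)) nl)))

  path+new : ∀ (m : Fin k) → ¬ NewLabel (fib (toℕ m) + fib k)
  path+new m nl = n≮n k (proj₂ (fib+fib (toℕ<n m) nl))

  no-edge : ∀ {v} → ¬ NewLabel v → ⊥ ⇔ NewLabel v
  no-edge ¬nl = mk⇔ ⊥-elim ¬nl

  no-edge-comm : ∀ x y → ¬ NewLabel (x + y) → ⊥ ⇔ NewLabel (y + x)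
  no-edge-comm x y ¬nl = no-edge (¬nl ∘ newLabel-comm y x)

  old≢old : ∀ {j j′} → j ≢ j′ → iv (old j) ≢ iv (old j′)
  old≢old j≢j′ = j≢j′ ∘ punchIn₂-injective i₁≢i₂ _ _ ∘ ↑ʳ-injective (n G) _ _

  Edge⇔newLabel : ∀ κ μ → κ ≢ μ → Edge κ μ ⇔ NewLabel (label κ + label μ)
  Edge⇔newLabel (graphV u) (graphV v) ne = graph-edge u v (ne ∘ cong graphV)
  Edge⇔newLabel (graphV u) (pathV m) _ = no-edge (kept+fib (graph-kept u) (toℕ m))
  Edge⇔newLabel (graphV u) newV _ = no-edge (kept+fib (graph-kept u) k)
  Edge⇔newLabel (graphV u) (oldV j) _ =
    no-edge (kept+isolated (old j) (old-kept j) (↑ˡ≢↑ʳ u i₁) (↑ˡ≢↑ʳ u (old j)))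
  Edge⇔newLabel (pathV m) (graphV u) _ = no-edge-comm (ℓ (u ↑ˡ S)) (fib (toℕ m)) (kept+fib (graph-kept u) (toℕ m))
  Edge⇔newLabel (pathV a) (pathV b) ne = path-edge a b (ne ∘ cong pathV)
  Edge⇔newLabel (pathV m) newV _ = no-edge (path+new m)
  Edge⇔newLabel (pathV m) (oldV j) _ = no-edge-comm (ℓ (iv (old j))) (fib (toℕ m)) (kept+fib (old-kept j) (toℕ m))
  Edge⇔newLabel newV (graphV u) _ = no-edge-comm (ℓ (u ↑ˡ S)) (fib k) (kept+fib (graph-kept u) k)
  Edge⇔newLabel newV (pathV m) _ = no-edge-comm (fib (toℕ m)) (fib k) (path+new m)
  Edge⇔newLabel newV newV ne = contradiction refl ne
  Edge⇔newLabel newV (oldV j) _ = no-edge-comm (ℓ (iv (old j))) (fib k) (kept+fib (old-kept j) k)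
  Edge⇔newLabel (oldV j) (graphV u) _ =
    no-edge-comm (ℓ (u ↑ˡ S)) (ℓ (iv (old j))) (kept+isolated (old j) (old-kept j) (↑ˡ≢↑ʳ u i₁) (↑ˡ≢↑ʳ u (old j)))
  Edge⇔newLabel (oldV j) (pathV m) _ = no-edge (kept+fib (old-kept j) (toℕ m))
  Edge⇔newLabel (oldV j) newV _ = no-edge (kept+fib (old-kept j) k)
  Edge⇔newLabel (oldV j) (oldV j′) ne =
    no-edge (kept+isolated (old j′) (old-kept j′) (proj₁ (old-kept j)) (old≢old (ne ∘ cong oldV)))

  label-injective : ∀ κ μ → label κ ≡ label μ → κ ≡ μ
  label-injective (graphV u) (graphV v) e = cong graphV (↑ˡ-injective S u v (inj L _ _ e))
  label-injective (graphV u) (pathV m) e = contradiction e (kept-label≢fib (graph-kept u) (toℕ m))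
  label-injective (graphV u) newV e = contradiction e (kept-label≢fib (graph-kept u) k)
  label-injective (graphV u) (oldV j) e = contradiction (inj L _ _ e) (↑ˡ≢↑ʳ u (old j))
  label-injective (pathV m) (graphV u) e = contradiction (sym e) (kept-label≢fib (graph-kept u) (toℕ m))
  label-injective (pathV a) (pathV b) e = cong pathV (toℕ-injective (fib-injective e))
  label-injective (pathV m) newV e = contradiction (fib-injective e) (<⇒≢ (toℕ<n m))
  label-injective (pathV m) (oldV j) e = contradiction (sym e) (kept-label≢fib (old-kept j) (toℕ m))
  label-injective newV (graphV u) e = contradiction (sym e) (kept-label≢fib (graph-kept u) k)
  label-injective newV (pathV m) e = contradiction (sym (fib-injective e)) (<⇒≢ (toℕ<n m))
  label-injective newV newV _ = refl
  label-injective newV (oldV j) e = contradiction (sym e) (kept-label≢fib (old-kept j) k)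
  label-injective (oldV j) (graphV u) e = contradiction (inj L _ _ (sym e)) (↑ˡ≢↑ʳ u (old j))
  label-injective (oldV j) (pathV m) e = contradiction e (kept-label≢fib (old-kept j) (toℕ m))
  label-injective (oldV j) newV e = contradiction e (kept-label≢fib (old-kept j) k)
  label-injective (oldV j) (oldV j′) e = cong oldV (punchIn₂-injective i₁≢i₂ _ _ (↑ʳ-injective (n G) _ _ (inj L _ _ e)))

  label-pos : ∀ κ → 0 < label κ
  label-pos (graphV u) = pos L _
  label-pos (pathV m) = fib-pos (toℕ m)
  label-pos newV = fib-pos k
  label-pos (oldV j) = pos L _

  sumLabelling : SumLabelling H
  sumLabelling = sumLabelling-via H vertices Edge Adj⇔Edge label label-injective label-pos Edge⇔newLabel

corollary14 : (G : Graph) → NoIsolated G → (s : ℕ) → IsSigma G s → 2 ≤ s →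
    (L : SumLabelling (G ⊕ N s)) →
    (i₁ i₂ : Fin s) → i₁ ≢ i₂ →
    lab L (n G ↑ʳ i₂) ≤ lab L (n G ↑ʳ i₁) →
    (∀ j → j ≢ i₁ → lab L (n G ↑ʳ j) ≤ lab L (n G ↑ʳ i₂)) →
    (∀ u v → lab L (n G ↑ʳ i₁) + lab L (n G ↑ʳ i₂) ≢ lab L (u ↑ˡ s) + lab L (v ↑ˡ s)) →
    (k : ℕ) → 2 ≤ k →
    ∃ λ t → t ≤ s ∸ 1 × IsSumGraph (G ⊕ P k ⊕ N t)
corollary14 G noIsolated (suc (suc r)) _ (s≤s (s≤s z≤n)) L i₁ i₂ i₁≢i₂ ι₂≤ι₁ ≤ι₂ ι₁+ι₂≢ k 2≤k =
  suc r , ≤-refl ,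
  Construction.sumLabelling G noIsolated r L i₁ i₂ i₁≢i₂ ι₂≤ι₁ ≤ι₂ ι₁+ι₂≢ k (≤-trans (s≤s z≤n) 2≤k)
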